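{- Let $n,m$ be such that $T_{n,m}$ is nonempty. Define $T^{(0)}_{n,m}=T_{n,m}$ and, for $i\in\{0,1,\ldots,m-1\}$, $T^{(i+1)}_{n,m}=\{G\in T^{(i)}_{n,m}: F_{i+1}(G)\geq F_{i+1}(H)\text{ for each }H\in T^{(i)}_{n,m}\}$. Then $T^{(m)}_{n,m}$ is nonempty and the set $\mathcal{G}_{n,m}$ of all locally most split reliable graphs in $T_{n,m}$ equals $T^{(m)}_{n,m}$.
   Context: A two-terminal graph is a connected simple graph with two distinct distinguished vertices $s,t$ (terminals). Two two-terminal graphs are isomorphic if there is a graph isomorphism mapping the terminal set onto the terminal set. $T_{n,m}$ is the set of all nonisomorphic connected simple two-terminal graphs with $n$ vertices and $m$ edges. A split subgraph of $G$ is a spanning subgraph of $G$ with exactly two connected components, one containing $s$ and the other containing $t$. $N_i(G)$ is the number of split subgraphs of $G$ with exactly $i$ edges and $F_i(G)=N_{m-i}(G)$. The split reliability is $SR_G(p)=\sum_i N_i(G)p^i(1-p)^{m-i}$. $G\in T_{n,m}$ is locally most split reliable if for each $H\in T_{n,m}$ there is $\delta>0$ with $SR_G(p)\geq SR_H(p)$ for all $p\in(1-\delta,1)$.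
   Formalization: In the definition of a locally most split reliable graph, the probability p and the number δ range over the rationals. -}

module Defs where

open import Data.Bool using (Bool; true; false; _∧_; _∨_; not)
open import Data.Nat as ℕ using (ℕ; zero; suc; _∸_; _≡ᵇ_)
open import Data.Fin using (Fin)
open import Data.Fin.Properties using (_≟_)
open import Data.List using (List; []; _∷_; map; _++_; length; filterᵇ; foldr; allFin; upTo)
open import Data.Bool.ListAction using (all; any)
open import Data.Integer using (+_)
open import Data.Vec using (Vec; []; _∷_; lookup)
open import Data.Product using (_×_; _,_; proj₁; proj₂; ∃)
open import Data.Sum using (_⊎_)
open import Data.Empty using (⊥)
open import Relation.Nullary using (¬_)
open import Relation.Nullary.Decidable using (⌊_⌋)
open import Relation.Binary.PropositionalEquality using (_≡_; _≢_)
open import Data.Rational as ℚ using (ℚ; 0ℚ; 1ℚ; _+_; _*_; _-_; _<_; _≤_)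

Edge : ℕ → Set
Edge n = Fin n × Fin n

SameEdge : ∀ {n} → Edge n → Edge n → Set
SameEdge (a , b) (c , d) = (a ≡ c × b ≡ d) ⊎ (a ≡ d × b ≡ c)

eqᵇ : ∀ {n} → Fin n → Fin n → Bool
eqᵇ x y = ⌊ x ≟ y ⌋

iter : {A : Set} → ℕ → (A → A) → A → A
iter zero    f x = x
iter (suc k) f x = f (iter k f x)

step : ∀ {n} → List (Edge n) → (Fin n → Bool) → Fin n → Bool
step es R v = R v ∨ any (λ e → (R (proj₁ e) ∧ eqᵇ (proj₂ e) v)
                             ∨ (R (proj₂ e) ∧ eqᵇ (proj₁ e) v)) es

-- reach es x v = true  iff  v lies in the connected component of x in the
-- graph on Fin n with edge list es (n rounds suffice: paths have < n edges)
reach : ∀ {n} → List (Edge n) → Fin n → Fin n → Bool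
reach {n} es x = iter n (step es) (eqᵇ x)

allVerts : ∀ {n} → (Fin n → Bool) → Bool
allVerts {n} P = all P (allFin n)

selected : ∀ {n m} → Vec (Edge n) m → Vec Bool m → List (Edge n)
selected []       []          = []
selected (e ∷ es) (true  ∷ S) = e ∷ selected es S
selected (e ∷ es) (false ∷ S) = selected es S

allEdges : ∀ {n m} → Vec (Edge n) m → List (Edge n)
allEdges []       = []
allEdges (e ∷ es) = e ∷ allEdges es

subsets : (m : ℕ) → List (Vec Bool m)
subsets zero    = [] ∷ []
subsets (suc m) = map (true ∷_) (subsets m) ++ map (false ∷_) (subsets m)

size : ∀ {m} → Vec Bool m → ℕ
size []          = 0
size (true  ∷ S) = suc (size S)
size (false ∷ S) = size S

record TwoTerminal (n m : ℕ) : Set where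
  field
    s t      : Fin n
    s≢t      : s ≢ t
    edges    : Vec (Edge n) m
    noLoop   : ∀ i → proj₁ (lookup edges i) ≢ proj₂ (lookup edges i)
    noMulti  : ∀ i j → i ≢ j → ¬ SameEdge (lookup edges i) (lookup edges j)
    connected : allVerts (reach (allEdges edges) s) ≡ true
open TwoTerminal public

-- the spanning subgraph with edge set S is a split subgraph:
-- exactly two components, one containing s and the other containing t
isSplit : ∀ {n m} → TwoTerminal n m → Vec Bool m → Bool
isSplit G S =
  not (reach es (s G) (t G))
  ∧ allVerts (λ v → reach es (s G) v ∨ reach es (t G) v)
  where es = selected (edges G) S

N : ∀ {n m} → ℕ → TwoTerminal n m → ℕ
N {m = m} i G = length (filterᵇ (λ S → (size S ≡ᵇ i) ∧ isSplit G S) (subsets m))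

F : ∀ {n m} → ℕ → TwoTerminal n m → ℕ
F {m = m} i G = N (m ∸ i) G

_^ᵣ_ : ℚ → ℕ → ℚ
x ^ᵣ zero  = 1ℚ
x ^ᵣ suc k = x * (x ^ᵣ k)

SR : ∀ {n m} → TwoTerminal n m → ℚ → ℚ
SR {m = m} G p =
  foldr (λ i acc → (((+ N i G) ℚ./ 1) * (p ^ᵣ i)) * ((1ℚ - p) ^ᵣ (m ∸ i)) + acc)
        0ℚ (upTo (suc m))

LocallyMostSplitReliable : ∀ {n m} → TwoTerminal n m → Set
LocallyMostSplitReliable {n} {m} G =
  (H : TwoTerminal n m) →
  ∃ λ (δ : ℚ) → (0ℚ < δ) ×
    ((p : ℚ) → (1ℚ - δ) < p → p < 1ℚ → SR H p ≤ SR G p)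

Tlevel : ∀ {n m} → ℕ → TwoTerminal n m → Set
Tlevel zero    G = Data.Unit.⊤ where import Data.Unit
Tlevel {n} {m} (suc i) G =
  Tlevel i G × ((H : TwoTerminal n m) → Tlevel i H → F (suc i) H ℕ.≤ F (suc i) G)

{-# OPTIONS --safe #-}
module Submission where

-- With q = 1 - p, SR_G(p) = Σ_j F_j(G) p^(m-j) q^j, so for p close to 1 the sign of
-- SR_G - SR_H is that of the first nonzero F_j(G) - F_j(H): this integer difference is at least 1,
-- while the remaining terms are q times a quantity bounded in terms of the N_i(H).  Hence G is
-- locally most split reliable iff (F_0(G), …, F_m(G)) is lexicographically maximal.  As
-- F_0 = N_m = 0 for connected graphs, that is exactly membership in T^(m); and T^(m) is nonempty
-- because T_{n,m} is finite, so each T^(i+1) maximises F_{i+1} over the nonempty T^(i).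

open import Defs
open import Data.Bool using (Bool; true; false; T; T?; _∧_)
import Data.Bool.Properties as Bool
open import Data.Empty using (⊥-elim)
open import Data.Fin using (Fin)
open import Data.Fin.Properties using (_≟_; all?)
open import Data.Integer as ℤ using (+_)
import Data.Integer.Properties as ℤP
open import Data.List
  using (List; []; _∷_; foldr; upTo; _∷ʳ_; filter; length; allFin; concatMap; cartesianProduct; cartesianProductWith)
import Data.List.Properties as ListP
open import Data.List.Extrema.Nat using (argmax; argmax-all; f[xs]≤f[argmax])
open import Data.List.Membership.Propositional using (_∈_; lose)
open import Data.List.Membership.Propositional.Properties
  using (∈-allFin; ∈-filter⁺; ∈-concatMap⁺; ∈-cartesianProduct⁺; ∈-cartesianProductWith⁺)
open import Data.List.Relation.Unary.All as All using (All; []; _∷_)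
import Data.List.Relation.Unary.All.Properties as AllP
open import Data.List.Relation.Unary.Any using (here)
open import Data.Nat as ℕ using (ℕ; zero; suc; _∸_; z≤n; s≤s)
import Data.Nat.Coprimality as Coprimality
import Data.Nat.Properties as ℕP
open import Data.Product using (_×_; _,_; proj₁; proj₂; ∃)
open import Data.Rational as ℚ using (ℚ; 0ℚ; 1ℚ; _+_; _*_; _-_; -_; _<_; _≤_; mkℚ)
import Data.Rational.Properties as ℚP
open import Data.Rational.Solver using (module +-*-Solver)
open +-*-Solver using (solve; _:+_; _:*_; _:-_; _:=_; con)
open import Data.Sum using (_⊎_; inj₁; inj₂)
open import Data.Vec using (Vec; []; _∷_; lookup)
open import Function using (_∘_)
open import Function.Bundles using (_⇔_; mk⇔; Equivalence)
import Function.Properties.Equivalence as ⇔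
open import Relation.Binary.Definitions using (tri<; tri≈; tri>)
open import Relation.Binary.PropositionalEquality
open import Relation.Nullary using (¬_; Dec; yes; no; ¬?)
open import Relation.Nullary.Decidable using (_×-dec_; _⊎-dec_; _→-dec_; map′)

fromℕ : ℕ → ℚ
fromℕ n = + n ℚ./ 1

fromℕ-homo-+ : ∀ a b → fromℕ (a ℕ.+ b) ≡ fromℕ a + fromℕ b
fromℕ-homo-+ a b = begin
  + (a ℕ.+ b) ℚ./ 1                     ≡⟨ ℚP./-cong numerators refl ⟩
  (+ a ℤ.* + 1 ℤ.+ + b ℤ.* + 1) ℚ./ 1   ≡⟨ cong₂ _+_ (fromℕ≡mkℚ a) (fromℕ≡mkℚ b) ⟨
  fromℕ a + fromℕ b                     ∎
  where
  open ≡-Reasoning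
  fromℕ≡mkℚ : ∀ n → fromℕ n ≡ mkℚ (+ n) 0 (Coprimality.sym (Coprimality.1-coprimeTo n))
  fromℕ≡mkℚ n = ℚP.normalize-coprime (Coprimality.sym (Coprimality.1-coprimeTo n))
  numerators : + (a ℕ.+ b) ≡ + a ℤ.* + 1 ℤ.+ + b ℤ.* + 1
  numerators = sym (cong₂ ℤ._+_ (ℤP.*-identityʳ (+ a)) (ℤP.*-identityʳ (+ b)))

fromℕ-nonNeg : ∀ n → 0ℚ ≤ fromℕ n
fromℕ-nonNeg n = ℚP.nonNegative⁻¹ (fromℕ n) {{ℚP.normalize-nonNeg n 1}}

p≤q⇒0≤q-p : ∀ {p q} → p ≤ q → 0ℚ ≤ q - p
p≤q⇒0≤q-p {p} {q} p≤q = subst (_≤ q - p) (ℚP.+-inverseʳ p) (ℚP.+-monoˡ-≤ (- p) p≤q)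

p<q⇒0<q-p : ∀ {p q} → p < q → 0ℚ < q - p
p<q⇒0<q-p {p} {q} p<q = subst (_< q - p) (ℚP.+-inverseʳ p) (ℚP.+-monoˡ-< (- p) p<q)

[q-p]+p≡q : ∀ p q → (q - p) + p ≡ q
[q-p]+p≡q = solve 2 (λ p q → (q :- p) :+ p := q) refl

0≤q-p⇒p≤q : ∀ {p q} → 0ℚ ≤ q - p → p ≤ q
0≤q-p⇒p≤q {p} {q} 0≤q-p = subst₂ _≤_ (ℚP.+-identityˡ p) ([q-p]+p≡q p q) (ℚP.+-monoˡ-≤ p 0≤q-p)

0<q-p⇒p<q : ∀ {p q} → 0ℚ < q - p → p < q
0<q-p⇒p<q {p} {q} 0<q-p = subst₂ _<_ (ℚP.+-identityˡ p) ([q-p]+p≡q p q) (ℚP.+-monoˡ-< p 0<q-p)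

1-[1-p]≡p : ∀ p → 1ℚ - (1ℚ - p) ≡ p
1-[1-p]≡p = solve 1 (λ p → con 1ℚ :- (con 1ℚ :- p) := p) refl

0≤* : ∀ {p q} → 0ℚ ≤ p → 0ℚ ≤ q → 0ℚ ≤ p * q
0≤* {p} {q} 0≤p 0≤q = ℚP.nonNegative⁻¹ (p * q)
  {{ℚP.nonNeg*nonNeg⇒nonNeg p {{ℚ.nonNegative 0≤p}} q {{ℚ.nonNegative 0≤q}}}}

0<* : ∀ {p q} → 0ℚ < p → 0ℚ < q → 0ℚ < p * q
0<* {p} {q} 0<p 0<q = ℚP.positive⁻¹ (p * q)
  {{ℚP.pos*pos⇒pos p {{ℚ.positive 0<p}} q {{ℚ.positive 0<q}}}}

0<1 : 0ℚ < 1ℚ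
0<1 = ℚP.positive⁻¹ 1ℚ

fromℕ-gap : ∀ {a b} → a ℕ.< b → 1ℚ ≤ fromℕ b - fromℕ a
fromℕ-gap {a} {b} a<b = 0≤q-p⇒p≤q (subst (0ℚ ≤_) gap (fromℕ-nonNeg k))
  where
  open ≡-Reasoning
  k : ℕ
  k = b ∸ suc a
  rearrange : ∀ a k → k ≡ ((1ℚ + a + k) - a) - 1ℚ
  rearrange = solve 2 (λ a k → k := ((con 1ℚ :+ a :+ k) :- a) :- con 1ℚ) refl
  split : fromℕ (suc a ℕ.+ k) ≡ 1ℚ + fromℕ a + fromℕ k
  split = trans (fromℕ-homo-+ (suc a) k) (cong (_+ fromℕ k) (fromℕ-homo-+ 1 a))
  gap : fromℕ k ≡ (fromℕ b - fromℕ a) - 1ℚ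
  gap = begin
    fromℕ k                                    ≡⟨ rearrange (fromℕ a) (fromℕ k) ⟩
    ((1ℚ + fromℕ a + fromℕ k) - fromℕ a) - 1ℚ  ≡⟨ cong (λ z → (z - fromℕ a) - 1ℚ) split ⟨
    (fromℕ (suc a ℕ.+ k) - fromℕ a) - 1ℚ
      ≡⟨ cong (λ z → (fromℕ z - fromℕ a) - 1ℚ) (ℕP.m+[n∸m]≡n a<b) ⟩
    (fromℕ b - fromℕ a) - 1ℚ                   ∎

0≤^ᵣ : ∀ {a} n → 0ℚ ≤ a → 0ℚ ≤ a ^ᵣ n
0≤^ᵣ zero    0≤a = ℚP.<⇒≤ 0<1
0≤^ᵣ (suc n) 0≤a = 0≤* 0≤a (0≤^ᵣ n 0≤a)

^ᵣ≤1 : ∀ {a} n → 0ℚ ≤ a → a ≤ 1ℚ → a ^ᵣ n ≤ 1ℚ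
^ᵣ≤1 zero    0≤a a≤1 = ℚP.≤-refl
^ᵣ≤1 {a} (suc n) 0≤a a≤1 = 0≤q-p⇒p≤q (subst (0ℚ ≤_) (split a (a ^ᵣ n))
  (ℚP.+-mono-≤ (p≤q⇒0≤q-p a≤1) (0≤* 0≤a (p≤q⇒0≤q-p (^ᵣ≤1 n 0≤a a≤1)))))
  where
  split : ∀ a b → (1ℚ - a) + a * (1ℚ - b) ≡ 1ℚ - a * b
  split = solve 2 (λ a b → (con 1ℚ :- a) :+ a :* (con 1ℚ :- b) := con 1ℚ :- a :* b) refl

bernoulli : ∀ {p} n → 0ℚ ≤ p → p ≤ 1ℚ → 1ℚ - (1ℚ - p) * fromℕ n ≤ p ^ᵣ n
bernoulli {p} zero 0≤p p≤1 = ℚP.≤-reflexive (base p)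
  where
  base : ∀ p → 1ℚ - (1ℚ - p) * 0ℚ ≡ 1ℚ
  base = solve 1 (λ p → con 1ℚ :- (con 1ℚ :- p) :* con 0ℚ := con 1ℚ) refl
bernoulli {p} (suc n) 0≤p p≤1 = 0≤q-p⇒p≤q (subst (0ℚ ≤_) (sym inductive-step)
  (ℚP.+-mono-≤ (0≤* 0≤p (p≤q⇒0≤q-p (bernoulli n 0≤p p≤1)))
               (0≤* (p≤q⇒0≤q-p p≤1) (0≤* (p≤q⇒0≤q-p p≤1) (fromℕ-nonNeg n)))))
  where
  expand : ∀ p P k → p * P - (1ℚ - (1ℚ - p) * (1ℚ + k))
                   ≡ p * (P - (1ℚ - (1ℚ - p) * k)) + (1ℚ - p) * ((1ℚ - p) * k)
  expand = solve 3 (λ p P k → p :* P :- (con 1ℚ :- (con 1ℚ :- p) :* (con 1ℚ :+ k))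
                           := p :* (P :- (con 1ℚ :- (con 1ℚ :- p) :* k)) :+ (con 1ℚ :- p) :* ((con 1ℚ :- p) :* k)) refl
  inductive-step : p ^ᵣ suc n - (1ℚ - (1ℚ - p) * fromℕ (suc n))
                 ≡ p * (p ^ᵣ n - (1ℚ - (1ℚ - p) * fromℕ n)) + (1ℚ - p) * ((1ℚ - p) * fromℕ n)
  inductive-step = trans (cong (λ z → p ^ᵣ suc n - (1ℚ - (1ℚ - p) * z)) (fromℕ-homo-+ 1 n))
                         (expand p (p ^ᵣ n) (fromℕ n))

poly : (ℕ → ℚ) → ℕ → ℚ → ℚ → ℚ
poly d zero    p q = d 0
poly d (suc m) p q = d (suc m) * p ^ᵣ suc m + q * poly d m p q

-- spelled exactly like SR, so that SR G is definitionally nForm (Nseq G) m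
nForm : (ℕ → ℕ) → ℕ → ℚ → ℚ
nForm x m p = foldr (λ i acc → fromℕ (x i) * p ^ᵣ i * (1ℚ - p) ^ᵣ (m ∸ i) + acc) 0ℚ (upTo (suc m))

foldr-scale : ∀ {t u : ℕ → ℚ} q z {xs} → All (λ i → u i ≡ q * t i) xs →
              foldr (λ i acc → u i + acc) z xs ≡ q * foldr (λ i acc → t i + acc) 0ℚ xs + z
foldr-scale q z [] = absorb q z
  where
  absorb : ∀ q z → z ≡ q * 0ℚ + z
  absorb = solve 2 (λ q z → z := q :* con 0ℚ :+ z) refl
foldr-scale {t} q z {i ∷ xs} (uᵢ≡qtᵢ ∷ rest) =
  trans (cong₂ _+_ uᵢ≡qtᵢ (foldr-scale q z rest)) (distrib q (t i) _ z)
  where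
  distrib : ∀ q a b z → q * a + (q * b + z) ≡ q * (a + b) + z
  distrib = solve 4 (λ q a b z → q :* a :+ (q :* b :+ z) := q :* (a :+ b) :+ z) refl

foldr-upTo≡poly : ∀ d m p q →
  foldr (λ i acc → d i * p ^ᵣ i * q ^ᵣ (m ∸ i) + acc) 0ℚ (upTo (suc m)) ≡ poly d m p q
foldr-upTo≡poly d zero p q = unit (d 0)
  where
  unit : ∀ a → a * 1ℚ * 1ℚ + 0ℚ ≡ a
  unit = solve 1 (λ a → a :* con 1ℚ :* con 1ℚ :+ con 0ℚ := a) refl
foldr-upTo≡poly d (suc m) p q = begin
  foldr (term (suc m)) 0ℚ (upTo (suc (suc m)))
    ≡⟨ cong (foldr (term (suc m)) 0ℚ) (ListP.upTo-∷ʳ (suc m)) ⟨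
  foldr (term (suc m)) 0ℚ (upTo (suc m) ∷ʳ suc m)
    ≡⟨ ListP.foldr-++ (term (suc m)) 0ℚ (upTo (suc m)) (suc m ∷ []) ⟩
  foldr (term (suc m)) (top + 0ℚ) (upTo (suc m))
    ≡⟨ foldr-scale q (top + 0ℚ) (AllP.applyUpTo⁺₁ (λ i → i) (suc m) lower-term) ⟩
  q * foldr (term m) 0ℚ (upTo (suc m)) + (top + 0ℚ)
    ≡⟨ cong (λ r → q * r + (top + 0ℚ)) (foldr-upTo≡poly d m p q) ⟩
  q * poly d m p q + (top + 0ℚ)
    ≡⟨ cong (λ k → q * poly d m p q + (d (suc m) * p ^ᵣ suc m * q ^ᵣ k + 0ℚ)) (ℕP.n∸n≡0 m) ⟩
  q * poly d m p q + (d (suc m) * p ^ᵣ suc m * 1ℚ + 0ℚ)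
    ≡⟨ reorder q (poly d m p q) (d (suc m) * p ^ᵣ suc m) ⟩
  poly d (suc m) p q ∎
  where
  open ≡-Reasoning
  term : ℕ → ℕ → ℚ → ℚ
  term k i acc = d i * p ^ᵣ i * q ^ᵣ (k ∸ i) + acc
  top : ℚ
  top = d (suc m) * p ^ᵣ suc m * q ^ᵣ (suc m ∸ suc m)
  lower-term : ∀ {i} → i ℕ.< suc m →
               d i * p ^ᵣ i * q ^ᵣ (suc m ∸ i) ≡ q * (d i * p ^ᵣ i * q ^ᵣ (m ∸ i))
  lower-term {i} (s≤s i≤m) =
    trans (cong (λ k → d i * p ^ᵣ i * q ^ᵣ k) (ℕP.+-∸-assoc 1 i≤m)) (pull (d i * p ^ᵣ i) q _)
    where
    pull : ∀ a q b → a * (q * b) ≡ q * (a * b)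
    pull = solve 3 (λ a q b → a :* (q :* b) := q :* (a :* b)) refl
  reorder : ∀ q r a → q * r + (a * 1ℚ + 0ℚ) ≡ a + q * r
  reorder = solve 3 (λ q r a → q :* r :+ (a :* con 1ℚ :+ con 0ℚ) := a :+ q :* r) refl

nForm≡poly : ∀ x m p → nForm x m p ≡ poly (fromℕ ∘ x) m p (1ℚ - p)
nForm≡poly x m p = foldr-upTo≡poly (fromℕ ∘ x) m p (1ℚ - p)

poly-sub : ∀ f g m p q → poly (λ i → f i - g i) m p q ≡ poly f m p q - poly g m p q
poly-sub f g zero    p q = refl
poly-sub f g (suc m) p q =
  trans (cong (λ r → (f (suc m) - g (suc m)) * p ^ᵣ suc m + q * r) (poly-sub f g m p q))
        (regroup (f (suc m)) (g (suc m)) (p ^ᵣ suc m) q (poly f m p q) (poly g m p q))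
  where
  regroup : ∀ a b P q r s → (a - b) * P + q * (r - s) ≡ (a * P + q * r) - (b * P + q * s)
  regroup = solve 6 (λ a b P q r s → (a :- b) :* P :+ q :* (r :- s)
                                   := (a :* P :+ q :* r) :- (b :* P :+ q :* s)) refl

poly-nonNeg : ∀ {d} m {p q} → (∀ i → 0ℚ ≤ d i) → 0ℚ ≤ p → 0ℚ ≤ q → 0ℚ ≤ poly d m p q
poly-nonNeg zero    0≤d 0≤p 0≤q = 0≤d 0
poly-nonNeg (suc m) 0≤d 0≤p 0≤q =
  ℚP.+-mono-≤ (0≤* (0≤d (suc m)) (0≤^ᵣ (suc m) 0≤p)) (0≤* 0≤q (poly-nonNeg m 0≤d 0≤p 0≤q))

partialSum : (ℕ → ℕ) → ℕ → ℕ
partialSum y zero    = y 0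
partialSum y (suc m) = y (suc m) ℕ.+ partialSum y m

*≤1⇒*≤ : ∀ {a b} → 0ℚ ≤ a → b ≤ 1ℚ → a * b ≤ a
*≤1⇒*≤ {a} {b} 0≤a b≤1 = begin
  a * b   ≤⟨ ℚP.*-monoˡ-≤-nonNeg a {{ℚ.nonNegative 0≤a}} b≤1 ⟩
  a * 1ℚ  ≡⟨ ℚP.*-identityʳ a ⟩
  a       ∎
  where open ℚP.≤-Reasoning

poly-≤-partialSum : ∀ y m {p q} → 0ℚ ≤ p → p ≤ 1ℚ → 0ℚ ≤ q → q ≤ 1ℚ →
                    poly (fromℕ ∘ y) m p q ≤ fromℕ (partialSum y m)
poly-≤-partialSum y zero    0≤p p≤1 0≤q q≤1 = ℚP.≤-refl
poly-≤-partialSum y (suc m) {p} {q} 0≤p p≤1 0≤q q≤1 = begin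
  fromℕ (y (suc m)) * p ^ᵣ suc m + q * poly (fromℕ ∘ y) m p q
    ≤⟨ ℚP.+-mono-≤ (*≤1⇒*≤ (fromℕ-nonNeg (y (suc m))) (^ᵣ≤1 (suc m) 0≤p p≤1))
                   (ℚP.≤-trans (ℚP.≤-reflexive (ℚP.*-comm q _))
                               (*≤1⇒*≤ (poly-nonNeg m (fromℕ-nonNeg ∘ y) 0≤p 0≤q) q≤1)) ⟩
  fromℕ (y (suc m)) + poly (fromℕ ∘ y) m p q
    ≤⟨ ℚP.+-monoʳ-≤ (fromℕ (y (suc m))) (poly-≤-partialSum y m 0≤p p≤1 0≤q q≤1) ⟩
  fromℕ (y (suc m)) + fromℕ (partialSum y m)
    ≡⟨ fromℕ-homo-+ (y (suc m)) (partialSum y m) ⟨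
  fromℕ (partialSum y (suc m)) ∎
  where open ℚP.≤-Reasoning

NearOne : (ℚ → Set) → Set
NearOne P = ∃ λ (δ : ℚ) → (0ℚ < δ) × ((p : ℚ) → 1ℚ - δ < p → p < 1ℚ → P p)

1-δ<p⇒1-p<δ : ∀ {δ p} → 1ℚ - δ < p → 1ℚ - p < δ
1-δ<p⇒1-p<δ {δ} {p} 1-δ<p = 0<q-p⇒p<q (subst (0ℚ <_) (swap δ p) (p<q⇒0<q-p 1-δ<p))
  where
  swap : ∀ δ p → p - (1ℚ - δ) ≡ δ - (1ℚ - p)
  swap = solve 2 (λ δ p → p :- (con 1ℚ :- δ) := δ :- (con 1ℚ :- p)) refl

NearOne-map : ∀ {P Q : ℚ → Set} → (∀ {p} → p < 1ℚ → P p → Q p) → NearOne P → NearOne Q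
NearOne-map P⇒Q (δ , 0<δ , P-near) = δ , 0<δ , λ p 1-δ<p p<1 → P⇒Q p<1 (P-near p 1-δ<p p<1)

NearOne-nonempty : ∀ {P : ℚ → Set} → NearOne P → ∃ P
NearOne-nonempty (δ , 0<δ , P-near) =
  let p , 1-δ<p , p<1 = ℚP.<-dense 1-δ<1 in p , P-near p 1-δ<p p<1
  where
  1-δ<1 : 1ℚ - δ < 1ℚ
  1-δ<1 = 0<q-p⇒p<q {1ℚ - δ} {1ℚ} (subst (0ℚ <_) (sym (1-[1-p]≡p δ)) 0<δ)

1-δ<p-mono : ∀ {δ δ′ p} → δ′ ≤ δ → 1ℚ - δ′ < p → 1ℚ - δ < p
1-δ<p-mono δ′≤δ = ℚP.≤-<-trans (ℚP.+-monoʳ-≤ 1ℚ (ℚP.neg-antimono-≤ δ′≤δ))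

NearOne-∩ : ∀ {P Q : ℚ → Set} → NearOne P → NearOne Q → NearOne (λ p → P p × Q p)
NearOne-∩ (δ₁ , 0<δ₁ , P-near) (δ₂ , 0<δ₂ , Q-near) with ℚP.≤-total δ₁ δ₂
... | inj₁ δ₁≤δ₂ = δ₁ , 0<δ₁ , λ p 1-δ<p p<1 →
  P-near p 1-δ<p p<1 , Q-near p (1-δ<p-mono δ₁≤δ₂ 1-δ<p) p<1
... | inj₂ δ₂≤δ₁ = δ₂ , 0<δ₂ , λ p 1-δ<p p<1 →
  P-near p (1-δ<p-mono δ₂≤δ₁ 1-δ<p) p<1 , Q-near p 1-δ<p p<1

infix 4 _≈[_]_ _<[_]_

_≈[_]_ : (ℕ → ℕ) → ℕ → (ℕ → ℕ) → Set
a ≈[ m ] b = ∀ {k} → k ℕ.≤ m → a k ≡ b k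

record _<[_]_ (a : ℕ → ℕ) (m : ℕ) (b : ℕ → ℕ) : Set where
  constructor differAt
  field
    index  : ℕ
    index≤ : index ℕ.≤ m
    agree  : ∀ {k} → k ℕ.< index → a k ≡ b k
    less   : a index ℕ.< b index

module _ {a b : ℕ → ℕ} where

  ≈[]-extend : ∀ {m} → a ≈[ m ] b → a (suc m) ≡ b (suc m) → a ≈[ suc m ] b
  ≈[]-extend a≈b eq k≤1+m with ℕP.m≤n⇒m<n∨m≡n k≤1+m
  ... | inj₁ k<1+m = a≈b (ℕP.≤-pred k<1+m)
  ... | inj₂ refl  = eq

  <[]-weaken : ∀ {m} → a <[ m ] b → a <[ suc m ] b
  <[]-weaken (differAt j j≤m agree less) = differAt j (ℕP.m≤n⇒m≤1+n j≤m) agree less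

  <[]-extend : ∀ {m} → a ≈[ m ] b → a (suc m) ℕ.< b (suc m) → a <[ suc m ] b
  <[]-extend a≈b less = differAt _ ℕP.≤-refl (λ k<1+m → a≈b (ℕP.≤-pred k<1+m)) less

  <[]-last : ∀ {m} → a <[ suc m ] b → a <[ m ] b ⊎ (a ≈[ m ] b × a (suc m) ℕ.< b (suc m))
  <[]-last (differAt j j≤1+m agree less) with ℕP.m≤n⇒m<n∨m≡n j≤1+m
  ... | inj₁ j<1+m = inj₁ (differAt j (ℕP.≤-pred j<1+m) agree less)
  ... | inj₂ refl  = inj₂ ((λ k≤m → agree (s≤s k≤m)) , less)

  <[0]⇒< : a <[ 0 ] b → a 0 ℕ.< b 0
  <[0]⇒< (differAt zero z≤n _ less) = less

  <[]-head : ∀ {m} → a <[ suc m ] b → a 0 ℕ.< b 0 ⊎ (a 0 ≡ b 0 × (a ∘ suc) <[ m ] (b ∘ suc))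
  <[]-head (differAt zero    _           _     less) = inj₁ less
  <[]-head (differAt (suc j) (s≤s j≤m) agree less) =
    inj₂ (agree (s≤s z≤n) , differAt j j≤m (λ k<j → agree (s≤s k<j)) less)

<[]-trichotomy : ∀ m a b → a <[ m ] b ⊎ a ≈[ m ] b ⊎ b <[ m ] a
<[]-trichotomy zero a b with ℕP.<-cmp (a 0) (b 0)
... | tri< lt _ _ = inj₁ (differAt 0 z≤n (λ ()) lt)
... | tri≈ _ eq _ = inj₂ (inj₁ λ { z≤n → eq })
... | tri> _ _ gt = inj₂ (inj₂ (differAt 0 z≤n (λ ()) gt))
<[]-trichotomy (suc m) a b with <[]-trichotomy m a b
... | inj₁ lt       = inj₁ (<[]-weaken lt)
... | inj₂ (inj₂ gt) = inj₂ (inj₂ (<[]-weaken gt))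
... | inj₂ (inj₁ eq) with ℕP.<-cmp (a (suc m)) (b (suc m))
...   | tri< lt _ _ = inj₁ (<[]-extend eq lt)
...   | tri≈ _ e _  = inj₂ (inj₁ (≈[]-extend eq e))
...   | tri> _ _ gt = inj₂ (inj₂ (<[]-extend (λ k≤m → sym (eq k≤m)) gt))

reflect : ℕ → (ℕ → ℕ) → ℕ → ℕ
reflect m x j = x (m ∸ j)

poly-cong : ∀ m {x y} → reflect m x ≈[ m ] reflect m y → ∀ p q →
            poly (fromℕ ∘ x) m p q ≡ poly (fromℕ ∘ y) m p q
poly-cong zero    x≈y p q = cong fromℕ (x≈y z≤n)
poly-cong (suc m) {x} {y} x≈y p q =
  cong₂ (λ a r → fromℕ a * p ^ᵣ suc m + q * r)
        (x≈y z≤n) (poly-cong m {x} {y} (λ k≤m → x≈y (s≤s k≤m)) p q)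

1-p≤1 : ∀ {p} → 0ℚ ≤ p → 1ℚ - p ≤ 1ℚ
1-p≤1 {p} 0≤p = 0≤q-p⇒p≤q {1ℚ - p} {1ℚ} (subst (0ℚ ≤_) (sym (1-[1-p]≡p p)) 0≤p)

leading-term-dominates : ∀ k {c r B p} → 0ℚ ≤ p → p ≤ 1ℚ → 1ℚ ≤ c → 0ℚ ≤ r + B →
                         (1ℚ - p) * (fromℕ k + B) < 1ℚ → 0ℚ < c * p ^ᵣ k + (1ℚ - p) * r
leading-term-dominates k {c} {r} {B} {p} 0≤p p≤1 1≤c 0≤r+B small =
  subst (0ℚ <_) (regroup c (p ^ᵣ k) p r B (fromℕ k))
    (ℚP.+-mono-<-≤ (p<q⇒0<q-p small)
      (ℚP.+-mono-≤ (ℚP.+-mono-≤ (0≤* (p≤q⇒0≤q-p 1≤c) (0≤^ᵣ k 0≤p))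
                                (p≤q⇒0≤q-p (bernoulli k 0≤p p≤1)))
                   (0≤* (p≤q⇒0≤q-p p≤1) 0≤r+B)))
  where
  regroup : ∀ c P p r B k →
    (1ℚ - (1ℚ - p) * (k + B)) + (((c - 1ℚ) * P + (P - (1ℚ - (1ℚ - p) * k))) + (1ℚ - p) * (r + B))
    ≡ c * P + (1ℚ - p) * r
  regroup = solve 6 (λ c P p r B k →
      (con 1ℚ :- (con 1ℚ :- p) :* (k :+ B))
        :+ (((c :- con 1ℚ) :* P :+ (P :- (con 1ℚ :- (con 1ℚ :- p) :* k))) :+ (con 1ℚ :- p) :* (r :+ B))
      := c :* P :+ (con 1ℚ :- p) :* r) refl

fromℕ-suc-positive : ∀ K → ℚ.Positive (fromℕ (suc K))
fromℕ-suc-positive K = ℚP.normalize-pos (suc K) 1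

fromℕ-suc-nonZero : ∀ K → ℚ.NonZero (fromℕ (suc K))
fromℕ-suc-nonZero K = ℚP.pos⇒nonZero (fromℕ (suc K)) {{fromℕ-suc-positive K}}

1/suc : ℕ → ℚ
1/suc K = (ℚ.1/ fromℕ (suc K)) {{fromℕ-suc-nonZero K}}

0<1/suc : ∀ K → 0ℚ < 1/suc K
0<1/suc K = ℚP.positive⁻¹ (1/suc K) {{ℚP.1/pos⇒pos (fromℕ (suc K)) {{fromℕ-suc-positive K}}}}

1/suc*suc≡1 : ∀ K → 1/suc K * fromℕ (suc K) ≡ 1ℚ
1/suc*suc≡1 K = ℚP.*-inverseˡ (fromℕ (suc K)) {{fromℕ-suc-nonZero K}}

<1/suc⇒*<1 : ∀ K {q} → q < 1/suc K → q * fromℕ (suc K) < 1ℚ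
<1/suc⇒*<1 K {q} q<δ = subst (q * fromℕ (suc K) <_) (1/suc*suc≡1 K)
  (ℚP.*-monoˡ-<-pos (fromℕ (suc K)) {{fromℕ-suc-positive K}} q<δ)

1≤fromℕ-suc : ∀ K → 1ℚ ≤ fromℕ (suc K)
1≤fromℕ-suc K = subst (1ℚ ≤_) (sym (fromℕ-homo-+ 1 K))
  (ℚP.≤-trans (ℚP.≤-reflexive (sym (ℚP.+-identityʳ 1ℚ))) (ℚP.+-monoʳ-≤ 1ℚ (fromℕ-nonNeg K)))

1/suc≤1 : ∀ K → 1/suc K ≤ 1ℚ
1/suc≤1 K = begin
  1/suc K
    ≡⟨ ℚP.*-identityʳ (1/suc K) ⟨
  1/suc K * 1ℚ
    ≤⟨ ℚP.*-monoˡ-≤-nonNeg (1/suc K) {{ℚ.nonNegative (ℚP.<⇒≤ (0<1/suc K))}} (1≤fromℕ-suc K) ⟩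
  1/suc K * fromℕ (suc K)
    ≡⟨ 1/suc*suc≡1 K ⟩
  1ℚ ∎
  where open ℚP.≤-Reasoning

diff : (ℕ → ℕ) → (ℕ → ℕ) → ℕ → ℚ
diff x y i = fromℕ (x i) - fromℕ (y i)

-- δ = 1/(m+1+Σy): then (1-p)(m+1+Σy) < 1, so Bernoulli and 0 ≤ poly y ≤ Σy make the leading term win
poly-pos-leading : ∀ m x y → y (suc m) ℕ.< x (suc m) →
                   NearOne (λ p → 0ℚ < poly (diff x y) (suc m) p (1ℚ - p))
poly-pos-leading m x y y<x = 1/suc K , 0<1/suc K , positive
  where
  K : ℕ
  K = m ℕ.+ partialSum y m
  B : ℚ
  B = fromℕ (partialSum y m)
  positive : ∀ p → 1ℚ - 1/suc K < p → p < 1ℚ → 0ℚ < poly (diff x y) (suc m) p (1ℚ - p)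
  positive p 1-δ<p p<1 =
    leading-term-dominates (suc m) {diff x y (suc m)} {poly (diff x y) m p (1ℚ - p)} {B} {p}
                           0≤p p≤1 (fromℕ-gap y<x) lower small
    where
    p≤1 : p ≤ 1ℚ
    p≤1 = ℚP.<⇒≤ p<1
    0≤p : 0ℚ ≤ p
    0≤p = ℚP.<⇒≤ (ℚP.≤-<-trans (p≤q⇒0≤q-p (1/suc≤1 K)) 1-δ<p)
    lower : 0ℚ ≤ poly (diff x y) m p (1ℚ - p) + B
    lower = subst (0ℚ ≤_)
      (trans (rearrange (poly (fromℕ ∘ x) m p (1ℚ - p)) (poly (fromℕ ∘ y) m p (1ℚ - p)) B)
             (cong (_+ B) (sym (poly-sub (fromℕ ∘ x) (fromℕ ∘ y) m p (1ℚ - p)))))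
      (ℚP.+-mono-≤ (poly-nonNeg m (fromℕ-nonNeg ∘ x) 0≤p (p≤q⇒0≤q-p p≤1))
                   (p≤q⇒0≤q-p (poly-≤-partialSum y m 0≤p p≤1 (p≤q⇒0≤q-p p≤1) (1-p≤1 0≤p))))
      where
      rearrange : ∀ a b B → a + (B - b) ≡ (a - b) + B
      rearrange = solve 3 (λ a b B → a :+ (B :- b) := (a :- b) :+ B) refl
    small : (1ℚ - p) * (fromℕ (suc m) + B) < 1ℚ
    small = subst (λ z → (1ℚ - p) * z < 1ℚ) (fromℕ-homo-+ (suc m) (partialSum y m))
                  (<1/suc⇒*<1 K (1-δ<p⇒1-p<δ 1-δ<p))

poly-pos-near-one : ∀ m x y → reflect m y <[ m ] reflect m x →
                    NearOne (λ p → 0ℚ < poly (diff x y) m p (1ℚ - p))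
poly-pos-near-one zero x y y<x = 1ℚ , 0<1 , λ _ _ _ → ℚP.<-≤-trans 0<1 (fromℕ-gap (<[0]⇒< y<x))
poly-pos-near-one (suc m) x y y<x with <[]-head y<x
... | inj₁ top<          = poly-pos-leading m x y top<
... | inj₂ (top≡ , rest) = NearOne-map drop-top (poly-pos-near-one m x y rest)
  where
  cancel : ∀ a P q r → (a - a) * P + q * r ≡ q * r
  cancel = solve 4 (λ a P q r → (a :- a) :* P :+ q :* r := q :* r) refl
  drop-top : ∀ {p} → p < 1ℚ → 0ℚ < poly (diff x y) m p (1ℚ - p) →
             0ℚ < poly (diff x y) (suc m) p (1ℚ - p)
  drop-top {p} p<1 0<r = subst (0ℚ <_) (sym vanish) (0<* (p<q⇒0<q-p p<1) 0<r)
    where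
    vanish : poly (diff x y) (suc m) p (1ℚ - p) ≡ (1ℚ - p) * poly (diff x y) m p (1ℚ - p)
    vanish = trans (cong (λ a → (fromℕ (x (suc m)) - fromℕ a) * p ^ᵣ suc m + (1ℚ - p) * r) top≡)
                   (cancel (fromℕ (x (suc m))) (p ^ᵣ suc m) (1ℚ - p) r)
      where
      r : ℚ
      r = poly (diff x y) m p (1ℚ - p)

nForm-<-near-one : ∀ m x y → reflect m y <[ m ] reflect m x → NearOne (λ p → nForm y m p < nForm x m p)
nForm-<-near-one m x y y<x = NearOne-map from-diff (poly-pos-near-one m x y y<x)
  where
  from-diff : ∀ {p} → p < 1ℚ → 0ℚ < poly (diff x y) m p (1ℚ - p) → nForm y m p < nForm x m p
  from-diff {p} _ 0<d = 0<q-p⇒p<q (subst (0ℚ <_) d≡x-y 0<d)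
    where
    d≡x-y : poly (diff x y) m p (1ℚ - p) ≡ nForm x m p - nForm y m p
    d≡x-y = trans (poly-sub (fromℕ ∘ x) (fromℕ ∘ y) m p (1ℚ - p))
                  (sym (cong₂ _-_ (nForm≡poly x m p) (nForm≡poly y m p)))

nForm-≤-near-one⇔ : ∀ m x y →
                    NearOne (λ p → nForm y m p ≤ nForm x m p) ⇔ (¬ reflect m x <[ m ] reflect m y)
nForm-≤-near-one⇔ m x y = mk⇔ not-below below
  where
  not-below : NearOne (λ p → nForm y m p ≤ nForm x m p) → ¬ reflect m x <[ m ] reflect m y
  not-below y≤x x<y =
    let p , y≤x[p] , x<y[p] = NearOne-nonempty (NearOne-∩ y≤x (nForm-<-near-one m y x x<y))
    in ℚP.<-irrefl {nForm y m p} {nForm y m p} refl (ℚP.≤-<-trans y≤x[p] x<y[p])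
  below : ¬ reflect m x <[ m ] reflect m y → NearOne (λ p → nForm y m p ≤ nForm x m p)
  below x≮y with <[]-trichotomy m (reflect m x) (reflect m y)
  ... | inj₁ x<y        = ⊥-elim (x≮y x<y)
  ... | inj₂ (inj₂ y<x) = NearOne-map (λ _ → ℚP.<⇒≤) (nForm-<-near-one m x y y<x)
  ... | inj₂ (inj₁ x≈y) = 1ℚ , 0<1 , λ p _ _ → ℚP.≤-reflexive (begin
    nForm y m p                     ≡⟨ nForm≡poly y m p ⟩
    poly (fromℕ ∘ y) m p (1ℚ - p)   ≡⟨ poly-cong m {x} {y} x≈y p (1ℚ - p) ⟨
    poly (fromℕ ∘ x) m p (1ℚ - p)   ≡⟨ nForm≡poly x m p ⟨
    nForm x m p                     ∎)
    where open ≡-Reasoning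

-- Fseq G is definitionally reflect m (Nseq G), because F j G = N (m ∸ j) G
Nseq Fseq : ∀ {n m} → TwoTerminal n m → ℕ → ℕ
Nseq G i = N i G
Fseq G j = F j G

size≤ : ∀ {m} (S : Vec Bool m) → size S ℕ.≤ m
size≤ []          = z≤n
size≤ (true  ∷ S) = s≤s (size≤ S)
size≤ (false ∷ S) = ℕP.m≤n⇒m≤1+n (size≤ S)

selected-full : ∀ {n m} (es : Vec (Edge n) m) (S : Vec Bool m) → size S ≡ m → selected es S ≡ allEdges es
selected-full []       []          _     = refl
selected-full (e ∷ es) (true  ∷ S) 1+s≡1+m = cong (e ∷_) (selected-full es S (ℕP.suc-injective 1+s≡1+m))
selected-full (e ∷ es) (false ∷ S) s≡1+m = ⊥-elim (ℕP.<-irrefl s≡1+m (s≤s (size≤ S)))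

s-reaches-t : ∀ {n m} (G : TwoTerminal n m) → reach (allEdges (edges G)) (s G) (t G) ≡ true
s-reaches-t {n} G = Equivalence.to Bool.T-≡ (All.lookup all-reached (∈-allFin (t G)))
  where
  all-reached : All (T ∘ reach (allEdges (edges G)) (s G)) (allFin n)
  all-reached = AllP.all⁺ _ (allFin n) (Equivalence.from Bool.T-≡ (connected G))

F-zero : ∀ {n m} (G : TwoTerminal n m) → F 0 G ≡ 0
F-zero {m = m} G = cong length (ListP.filter-none (T? ∘ isSpanningSplit) (All.universal notSplit (subsets m)))
  where
  isSpanningSplit : Vec Bool m → Bool
  isSpanningSplit S = (size S ℕ.≡ᵇ m) ∧ isSplit G S
  notSplit : ∀ S → ¬ T (isSpanningSplit S)
  notSplit S h with Equivalence.to Bool.T-∧ h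
  ... | full , split rewrite selected-full (edges G) S (ℕP.≡ᵇ⇒≡ (size S) m full) | s-reaches-t G = split

module _ {n m : ℕ} where

  LexMaximal : ℕ → TwoTerminal n m → Set
  LexMaximal i G = (H : TwoTerminal n m) → ¬ Fseq G <[ i ] Fseq H

  Tlevel-agree : ∀ i {G H : TwoTerminal n m} → Tlevel i G → Tlevel i H → Fseq G ≈[ i ] Fseq H
  Tlevel-agree zero    {G} {H} _           _           z≤n = trans (F-zero G) (sym (F-zero H))
  Tlevel-agree (suc i) {G} {H} (tG , maxG) (tH , maxH) =
    ≈[]-extend (Tlevel-agree i tG tH) (ℕP.≤-antisym (maxH G tG) (maxG H tH))

  Tlevel-resp-≈ : ∀ i {G H : TwoTerminal n m} → Fseq G ≈[ i ] Fseq H → Tlevel i G → Tlevel i H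
  Tlevel-resp-≈ zero    _   _           = _
  Tlevel-resp-≈ (suc i) G≈H (tG , maxG) =
    Tlevel-resp-≈ i (λ k≤i → G≈H (ℕP.m≤n⇒m≤1+n k≤i)) tG ,
    λ K tK → subst (F (suc i) K ℕ.≤_) (G≈H ℕP.≤-refl) (maxG K tK)

  Tlevel⇒LexMaximal : ∀ i {G : TwoTerminal n m} → Tlevel i G → LexMaximal i G
  Tlevel⇒LexMaximal zero    {G} _           H G<H = ℕP.<-irrefl (trans (F-zero G) (sym (F-zero H))) (<[0]⇒< G<H)
  Tlevel⇒LexMaximal (suc i)     (tG , maxG) H G<H with <[]-last G<H
  ... | inj₁ G<H′         = Tlevel⇒LexMaximal i tG H G<H′
  ... | inj₂ (G≈H , less) = ℕP.<⇒≱ less (maxG H (Tlevel-resp-≈ i G≈H tG))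

  LexMaximal⇒Tlevel : ∀ i {G : TwoTerminal n m} → LexMaximal i G → Tlevel i G
  LexMaximal⇒Tlevel zero    _       = _
  LexMaximal⇒Tlevel (suc i) {G} maximal =
    tG , λ H tH → ℕP.≮⇒≥ (λ less → maximal H (<[]-extend (Tlevel-agree i tG tH) less))
    where
    tG : Tlevel i G
    tG = LexMaximal⇒Tlevel i (λ H G<H → maximal H (<[]-weaken G<H))

  Tlevel⇔LexMaximal : ∀ i (G : TwoTerminal n m) → Tlevel i G ⇔ LexMaximal i G
  Tlevel⇔LexMaximal i G = mk⇔ (Tlevel⇒LexMaximal i) (LexMaximal⇒Tlevel i)

  LocallyMostSplitReliable⇔LexMaximal : ∀ (G : TwoTerminal n m) → LocallyMostSplitReliable G ⇔ LexMaximal m G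
  LocallyMostSplitReliable⇔LexMaximal G = mk⇔
    (λ reliable H → Equivalence.to   (nForm-≤-near-one⇔ m (Nseq G) (Nseq H)) (reliable H))
    (λ maximal  H → Equivalence.from (nForm-≤-near-one⇔ m (Nseq G) (Nseq H)) (maximal H))

vectors : ∀ {A : Set} → List A → (m : ℕ) → List (Vec A m)
vectors xs zero    = [] ∷ []
vectors xs (suc m) = cartesianProductWith _∷_ xs (vectors xs m)

∈-vectors : ∀ {A : Set} {xs : List A} → (∀ a → a ∈ xs) → ∀ {m} (v : Vec A m) → v ∈ vectors xs m
∈-vectors all∈ []      = here refl
∈-vectors all∈ (a ∷ v) = ∈-cartesianProductWith⁺ _∷_ (all∈ a) (∈-vectors all∈ v)

IsTwoTerminal : ∀ {n m} → Fin n → Fin n → Vec (Edge n) m → Set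
IsTwoTerminal s t es =
  s ≢ t
  × (∀ i → proj₁ (lookup es i) ≢ proj₂ (lookup es i))
  × (∀ i j → i ≢ j → ¬ SameEdge (lookup es i) (lookup es j))
  × allVerts (reach (allEdges es) s) ≡ true

sameEdge? : ∀ {n} (e f : Edge n) → Dec (SameEdge e f)
sameEdge? (a , b) (c , d) = ((a ≟ c) ×-dec (b ≟ d)) ⊎-dec ((a ≟ d) ×-dec (b ≟ c))

isTwoTerminal? : ∀ {n m} s t (es : Vec (Edge n) m) → Dec (IsTwoTerminal s t es)
isTwoTerminal? s t es =
  ¬? (s ≟ t)
  ×-dec all? (λ i → ¬? (proj₁ (lookup es i) ≟ proj₂ (lookup es i)))
  ×-dec all? (λ i → all? λ j → ¬? (i ≟ j) →-dec ¬? (sameEdge? (lookup es i) (lookup es j)))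
  ×-dec (allVerts (reach (allEdges es) s) Bool.≟ true)

graphsOn : ∀ {n m} → Fin n × Fin n × Vec (Edge n) m → List (TwoTerminal n m)
graphsOn (s , t , es) with isTwoTerminal? s t es
... | yes (s≢t , noLoop , noMulti , connected) =
  record { s = s ; t = t ; s≢t = s≢t ; edges = es
         ; noLoop = noLoop ; noMulti = noMulti ; connected = connected } ∷ []
... | no _ = []

triples : ∀ n m → List (Fin n × Fin n × Vec (Edge n) m)
triples n m =
  cartesianProduct (allFin n) (cartesianProduct (allFin n) (vectors (cartesianProduct (allFin n) (allFin n)) m))

∈-triples : ∀ {n m} s t (es : Vec (Edge n) m) → (s , t , es) ∈ triples n m
∈-triples s t es =
  ∈-cartesianProduct⁺ (∈-allFin s) (∈-cartesianProduct⁺ (∈-allFin t) (∈-vectors ∈-edges es))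
  where
  ∈-edges : ∀ e → e ∈ cartesianProduct (allFin _) (allFin _)
  ∈-edges (a , b) = ∈-cartesianProduct⁺ (∈-allFin a) (∈-allFin b)

allGraphs : ∀ n m → List (TwoTerminal n m)
allGraphs n m = concatMap graphsOn (triples n m)

-- only up to Fseq: without function extensionality the proof fields of a TwoTerminal are not unique
graphsOn-complete : ∀ {n m} (H : TwoTerminal n m) →
                    ∃ λ H′ → H′ ∈ graphsOn (s H , t H , edges H) × Fseq H′ ≗ Fseq H
graphsOn-complete H with isTwoTerminal? (s H) (t H) (edges H)
... | yes _   = _ , here refl , λ _ → refl
... | no ¬isH = ⊥-elim (¬isH (s≢t H , noLoop H , noMulti H , connected H))

allGraphs-complete : ∀ {n m} (H : TwoTerminal n m) → ∃ λ H′ → H′ ∈ allGraphs n m × Fseq H′ ≗ Fseq H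
allGraphs-complete H =
  let H′ , H′∈ , H′≗H = graphsOn-complete H
  in H′ , ∈-concatMap⁺ graphsOn (lose (∈-triples (s H) (t H) (edges H)) H′∈) , H′≗H

_≈?[_]_ : ∀ a m b → Dec (a ≈[ m ] b)
a ≈?[ m ] b = map′ (λ h {k} k≤m → h (s≤s k≤m)) (λ h {k} k<1+m → h (ℕP.≤-pred k<1+m))
                   (ℕP.allUpTo? (λ k → a k ℕ.≟ b k) (suc m))

module _ {A : Set} {P : A → Set} (P? : ∀ a → Dec (P a)) (f : A → ℕ) where

  maximum-exists : ∀ (xs : List A) {a₀} → P a₀ →
                   ∃ λ a → P a × (∀ {x} → x ∈ xs → P x → f x ℕ.≤ f a)
  maximum-exists xs {a₀} Pa₀ =
    argmax f a₀ (filter P? xs) ,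
    argmax-all f {P = P} Pa₀ (AllP.all-filter P? xs) ,
    λ x∈xs Px → All.lookup (f[xs]≤f[argmax] {f = f} a₀ (filter P? xs)) (∈-filter⁺ P? x∈xs Px)

Tlevel-nonempty : ∀ {n m} → TwoTerminal n m → ∀ i → ∃ (Tlevel {n} {m} i)
Tlevel-nonempty G₀ zero = G₀ , _
Tlevel-nonempty {n} {m} G₀ (suc i) = extend (Tlevel-nonempty G₀ i)
  where
  extend : ∃ (Tlevel i) → ∃ (Tlevel (suc i))
  extend (G₁ , t₁) =
    pick (maximum-exists (λ H → Fseq H ≈?[ i ] Fseq G₁) (F (suc i)) (allGraphs n m) {G₁} (λ _ → refl))
    where
    pick : (∃ λ G → Fseq G ≈[ i ] Fseq G₁
                  × (∀ {H} → H ∈ allGraphs n m → Fseq H ≈[ i ] Fseq G₁ → F (suc i) H ℕ.≤ F (suc i) G))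
         → ∃ (Tlevel (suc i))
    pick (G , G≈G₁ , G-max) = G , Tlevel-resp-≈ i (λ k≤i → sym (G≈G₁ k≤i)) t₁ , maximal
      where
      maximal : (H : TwoTerminal n m) → Tlevel i H → F (suc i) H ℕ.≤ F (suc i) G
      maximal H tH =
        let H′ , H′∈ , H′≗H = allGraphs-complete H
        in subst (ℕ._≤ F (suc i) G) (H′≗H (suc i))
                 (G-max H′∈ (λ {k} k≤i → trans (H′≗H k) (Tlevel-agree i tH t₁ k≤i)))

lemma2 : (n m : ℕ) → TwoTerminal n m →
    (∃ λ (G : TwoTerminal n m) → Tlevel m G)
    × ((G : TwoTerminal n m) → LocallyMostSplitReliable G ⇔ Tlevel m G)
lemma2 n m G₀ =
  Tlevel-nonempty G₀ m ,
  λ G → ⇔.trans (LocallyMostSplitReliable⇔LexMaximal G) (⇔.sym (Tlevel⇔LexMaximal m G))
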